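{- Let $S$ be a subdivided star of order $s$ with root $x$, each of whose arms has exactly $1$, $2$ or $4$ vertices other than $x$; for $i\in\{1,2,4\}$ let $a_i$ be the number of arms with exactly $i$ vertices other than $x$, and let $a_0\ge 0$ be an integer (the number of further neighbours of $x$ outside $S$, which have degree at least 3), with $d(x)=a_0+a_1+a_2+a_4\le 6$. Let $L=\{\ell_v\}$ be a list assignment on $V(S)$ such that $\ell_v=\{1,2,3\}$ if $v$ is neither a leaf nor the root, $\ell_v\subset\{1,2,3\}$ with $|\ell_v|=2$ if $v$ is a leaf, and $\ell_x\subseteq\{1,2,3\}$ with $|\ell_x|\ge 2$. Let $\varepsilon=3\lceil s/3\rceil-s$. If $2a_4+a_2\ge a_1+1+\varepsilon$ and $a_4\ge d(x)-4$, then $S$ is descending-equitably $L$-colorable.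
   Context: A subdivided star with root $x$ is a tree obtained from a star centered at $x$ by replacing its edges with paths ("arms"); the leaves are the endpoints of the arms other than $x$ (for an arm with one vertex besides $x$, that vertex is the leaf). A graph $H$ with list assignment $L=\{\ell_v\}$, $\ell_v\subseteq\{1,2,3\}$, is descending-equitably $L$-colorable if it has a proper coloring with $c(v)\in\ell_v$ for all $v$ whose color classes $V_1,V_2,V_3$ satisfy $|V_1|\ge|V_2|\ge|V_3|\ge|V_1|-1$. -}

module Defs where

open import Data.Nat using (ℕ; zero; suc; _+_; _*_; _∸_; _≤_; _<_; _/_)
import Data.Nat as ℕ
open import Data.Fin using (Fin; toℕ)
import Data.Fin as Fin
open import Data.Fin.Subset using (Subset)
import Data.Fin.Subset as Sub
open import Data.List using (List; length; lookup; map; concatMap; allFin; filter; _∷_)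
open import Relation.Binary.PropositionalEquality using (_≡_; _≢_)
open import Data.Product using (Σ; _×_; ∃)

-- A subdivided star is given by the list of its arm lengths
-- (number of vertices of each arm other than the root x).
-- Vertices: the root, and node i j = the (j+1)-th vertex of arm i
-- (j = 0 is the neighbour of the root).
data Vtx (arms : List ℕ) : Set where
  root : Vtx arms
  node : (i : Fin (length arms)) → Fin (lookup arms i) → Vtx arms

data Edge (arms : List ℕ) : Vtx arms → Vtx arms → Set where
  rootE : ∀ i j → toℕ j ≡ 0 → Edge arms root (node i j)
  armE  : ∀ i j k → suc (toℕ j) ≡ toℕ k → Edge arms (node i j) (node i k)

data IsLeaf (arms : List ℕ) : Vtx arms → Set where
  leaf : ∀ i j → suc (toℕ j) ≡ lookup arms i → IsLeaf arms (node i j)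

data IsInner (arms : List ℕ) : Vtx arms → Set where
  inner : ∀ i j → suc (toℕ j) < lookup arms i → IsInner arms (node i j)

allVtx : (arms : List ℕ) → List (Vtx arms)
allVtx arms = root ∷ concatMap (λ i → map (node i) (allFin (lookup arms i))) (allFin (length arms))

order : List ℕ → ℕ
order arms = length (allVtx arms)

numArms : List ℕ → ℕ → ℕ
numArms arms i = length (filter (ℕ._≟ i) arms)

-- Colours 1,2,3 are represented by Fin 3 elements 0,1,2.
c1 c2 c3 : Fin 3
c1 = Fin.zero
c2 = Fin.suc Fin.zero
c3 = Fin.suc (Fin.suc Fin.zero)

classSize : (arms : List ℕ) → (Vtx arms → Fin 3) → Fin 3 → ℕ
classSize arms c k = length (filter (λ v → c v Fin.≟ k) (allVtx arms))

IsProperLColoring : (arms : List ℕ) → (Vtx arms → Subset 3) → (Vtx arms → Fin 3) → Set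
IsProperLColoring arms ℓ c =
  (∀ v → c v Sub.∈ ℓ v) × (∀ u v → Edge arms u v → c u ≢ c v)

DescEquitable : (arms : List ℕ) → (Vtx arms → Fin 3) → Set
DescEquitable arms c =
  classSize arms c c2 ≤ classSize arms c c1 ×
  classSize arms c c3 ≤ classSize arms c c2 ×
  classSize arms c c1 ≤ suc (classSize arms c c3)

DescEquitablyLColorable : (arms : List ℕ) → (Vtx arms → Subset 3) → Set
DescEquitablyLColorable arms ℓ =
  Σ (Vtx arms → Fin 3) λ c → IsProperLColoring arms ℓ c × DescEquitable arms c

-- ε = 3⌈s/3⌉ - s, with ⌈s/3⌉ = (s+2)/3.
epsilon : ℕ → ℕ
epsilon s = 3 * ((s + 2) / 3) ∸ s

-- Fix a root color r.  An arm of length k whose leaf list misses the color m behaves like a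
-- gadget: a fixed vector of color counts, plus some pair slots, each adding two distinct colors
-- (every color but a freely chosen one), plus some single slots, each adding one freely chosen
-- color other than r.  The numbers of slots depend only on (k, m, r), and every choice of slot
-- contents is realized by a proper coloring of the arm.  Slot contributions simply add up, so the
-- star has a coloring with the descending-equitable class sizes ⌈s/3⌉, ⌈(s-1)/3⌉, ⌊s/3⌋ as soon as
-- suitable numbers of omitted and of single colors exist, and whether they do depends only on how
-- many arms of each of the nine types the star has.  For every multiplicity vector allowed by the
-- hypotheses (at most six arms) a computation finds such numbers for at least two root colors,
-- and one of them lies in ℓ_x because |ℓ_x| ≥ 2.

module Submission where

open import Defs
open import Data.Bool using (Bool; true; false; _∧_; _∨_; not; if_then_else_)
open import Data.Empty using (⊥-elim)
open import Data.Fin using (Fin; zero; suc; toℕ; fromℕ; punchIn; _≟_; _↑ˡ_; _↑ʳ_)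
open import Data.Fin.Properties using (all?; toℕ-injective; toℕ-fromℕ; toℕ<n)
open import Data.Fin.Subset using (Subset; ∣_∣; ⊤; _∈_; inside; outside)
open import Data.Fin.Subset.Properties using (∈⊤)
open import Data.List using (List; []; _∷_; [_]; concatMap; map; length; filter)
import Data.List as List
import Data.List.Properties as Listₚ
open import Data.List.Membership.Propositional.Properties using (∈-lookup)
open import Data.List.Relation.Unary.All using (All; []; _∷_)
import Data.List.Relation.Unary.All as All
open import Data.List.Relation.Unary.Any using (Any; any?; satisfied)
open import Data.Nat using (ℕ; zero; suc; _+_; _*_; _∸_; _<_; _≤_; _/_; z≤n; s<s⁻¹)
import Data.Nat as ℕ
open import Data.Nat.DivMod using (/-monoˡ-≤; m/n≡1+[m∸n]/n)
open import Data.Nat.ListAction using (sum)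
open import Data.Nat.ListAction.Properties using (sum-++)
open import Data.Nat.Properties
  using (suc-injective; +-assoc; +-comm; +-suc; +-identityʳ; *-identityʳ; *-distribʳ-+;
         ≤-trans; ≤-reflexive; ≤-pred; <-trans; n<1+n; n≤1+n; m≤m+n; m≤n+m; m≤n⇒m<n∨m≡n;
         +-mono-≤; +-monoʳ-≤; +-cancelʳ-≤; m+n≤o⇒m≤o; m+n≤o⇒m≤o∸n; m+n∸n≡m; +-commutativeSemigroup; +-0-commutativeMonoid)
open import Algebra.Properties.CommutativeSemigroup +-commutativeSemigroup using (interchange; x∙yz≈y∙xz)
open import Algebra.Properties.CommutativeMonoid.Sum +-0-commutativeMonoid
  using (sum-cong-≗; ∑-distrib-+) renaming (sum to ∑)
open import Data.Product using (Σ; ∃; _×_; _,_; proj₁; proj₂)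
open import Data.Sum using (_⊎_; inj₁; inj₂)
open import Data.Vec using (Vec; []; _∷_; lookup; zipWith; replicate; take; drop; _++_; cast; here; there)
import Data.Vec as Vec
import Data.Vec.Properties as Vecₚ
open import Function using (_∘_; id)
open import Relation.Binary.PropositionalEquality
  using (_≡_; _≢_; refl; sym; trans; cong; cong₂; subst; subst₂; module ≡-Reasoning)
open import Relation.Nullary using (Dec; yes; no; does)
open import Relation.Nullary.Decidable using (map′; _×-dec_; dec-true)

Color : Set
Color = Fin 3

Counts : Set
Counts = Vec ℕ 3

infixl 6 _⊕_
_⊕_ : Counts → Counts → Counts
_⊕_ = zipWith _+_

indicator : Bool → ℕ
indicator b = if b then 1 else 0

unit : Color → Counts
unit x = Vec.tabulate λ c → indicator (does (x ≟ c))

omitting : Color → Counts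
omitting x = Vec.tabulate λ c → indicator (not (does (x ≟ c)))

tally : ∀ {A : Set} {n} → (A → Counts) → Vec A n → Counts
tally f []       = replicate 3 0
tally f (x ∷ xs) = f x ⊕ tally f xs

lookup-⊕ : ∀ a b c → lookup (a ⊕ b) c ≡ lookup a c + lookup b c
lookup-⊕ a b c = Vecₚ.lookup-zipWith _+_ c a b

lookup-unit : ∀ x c → lookup (unit x) c ≡ indicator (does (x ≟ c))
lookup-unit x = Vecₚ.lookup∘tabulate _

tally-cast : ∀ {A : Set} (f : A → Counts) {m n} .(eq : m ≡ n) (xs : Vec A m) →
             tally f (cast eq xs) ≡ tally f xs
tally-cast f {n = zero}  eq []       = refl
tally-cast f {n = suc n} eq (x ∷ xs) = cong (f x ⊕_) (tally-cast f (cong ℕ.pred eq) xs)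

∑-one : ∀ n → ∑ {n} (λ _ → 1) ≡ n
∑-one zero    = refl
∑-one (suc n) = cong suc (∑-one n)

lookup-tally-unit : ∀ {k} (w : Vec Color k) c →
                    lookup (tally unit w) c ≡ ∑ (λ j → indicator (does (lookup w j ≟ c)))
lookup-tally-unit []      c = Vecₚ.lookup-replicate c 0
lookup-tally-unit (x ∷ w) c =
  trans (lookup-⊕ (unit x) (tally unit w) c) (cong₂ _+_ (lookup-unit x c) (lookup-tally-unit w c))

module _ {A : Set} where

  lookup-tally-++ : ∀ (f : A → Counts) {m n} (xs : Vec A m) (ys : Vec A n) c →
                    lookup (tally f (xs ++ ys)) c ≡ lookup (tally f xs) c + lookup (tally f ys) c
  lookup-tally-++ f []       ys c = sym (cong (_+ lookup (tally f ys) c) (Vecₚ.lookup-replicate c 0))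
  lookup-tally-++ f (x ∷ xs) ys c = begin
    lookup (f x ⊕ tally f (xs ++ ys)) c  ≡⟨ lookup-⊕ (f x) _ c ⟩
    fx + lookup (tally f (xs ++ ys)) c   ≡⟨ cong (fx +_) (lookup-tally-++ f xs ys c) ⟩
    fx + (tally-xs + tally-ys)           ≡⟨ sym (+-assoc fx _ _) ⟩
    fx + tally-xs + tally-ys             ≡⟨ cong (_+ tally-ys) (sym (lookup-⊕ (f x) _ c)) ⟩
    lookup (f x ⊕ tally f xs) c + tally-ys ∎
    where
    open ≡-Reasoning
    fx = lookup (f x) c
    tally-xs = lookup (tally f xs) c
    tally-ys = lookup (tally f ys) c

  split : ∀ {n} (P : Fin n → ℕ) → Vec A (∑ P) → (i : Fin n) → Vec A (P i)
  split {suc n} P xs zero    = take (P zero) xs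
  split {suc n} P xs (suc i) = split (P ∘ suc) (drop (P zero) xs) i

  tally-split : ∀ (f : A → Counts) {n} (P : Fin n → ℕ) xs c →
                ∑ (λ i → lookup (tally f (split P xs i)) c) ≡ lookup (tally f xs) c
  tally-split f {zero}  P [] c = sym (Vecₚ.lookup-replicate c 0)
  tally-split f {suc n} P xs c = begin
    lookup (tally f front) c + ∑ (λ i → lookup (tally f (split (P ∘ suc) rest i)) c)
      ≡⟨ cong (lookup (tally f front) c +_) (tally-split f (P ∘ suc) rest c) ⟩
    lookup (tally f front) c + lookup (tally f rest) c
      ≡⟨ sym (lookup-tally-++ f front rest c) ⟩
    lookup (tally f (front ++ rest)) c
      ≡⟨ cong (λ ys → lookup (tally f ys) c) (Vecₚ.take++drop≡id (P zero) xs) ⟩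
    lookup (tally f xs) c ∎
    where
    open ≡-Reasoning
    front = take (P zero) xs
    rest = drop (P zero) xs

  length-filter≡sum : ∀ {p} {P : A → Set p} (P? : ∀ x → Dec (P x)) xs →
                      length (filter P? xs) ≡ sum (map (indicator ∘ does ∘ P?) xs)
  length-filter≡sum P? []       = refl
  length-filter≡sum P? (x ∷ xs) with does (P? x)
  ... | true  = cong suc (length-filter≡sum P? xs)
  ... | false = length-filter≡sum P? xs

  length-concatMap : ∀ {B : Set} (g : A → List B) xs →
                     length (concatMap g xs) ≡ sum (map (length ∘ g) xs)
  length-concatMap g []       = refl
  length-concatMap g (x ∷ xs) =
    trans (Listₚ.length-++ (g x)) (cong (length (g x) +_) (length-concatMap g xs))

  sum-map-concatMap : ∀ {B : Set} (f : B → ℕ) (g : A → List B) xs →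
                      sum (map f (concatMap g xs)) ≡ sum (map (sum ∘ map f ∘ g) xs)
  sum-map-concatMap f g []       = refl
  sum-map-concatMap f g (x ∷ xs) = begin
    sum (map f (g x List.++ concatMap g xs))           ≡⟨ cong sum (Listₚ.map-++ f (g x) _) ⟩
    sum (map f (g x) List.++ map f (concatMap g xs))   ≡⟨ sum-++ (map f (g x)) _ ⟩
    sum (map f (g x)) + sum (map f (concatMap g xs))   ≡⟨ cong (sum (map f (g x)) +_) (sum-map-concatMap f g xs) ⟩
    sum (map f (g x)) + sum (map (sum ∘ map f ∘ g) xs) ∎
    where open ≡-Reasoning

  sum-map-tabulate : ∀ {n} (f : A → ℕ) (g : Fin n → A) → sum (map f (List.tabulate g)) ≡ ∑ (f ∘ g)
  sum-map-tabulate {zero}  f g = refl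
  sum-map-tabulate {suc n} f g = cong (f (g zero) +_) (sum-map-tabulate f (g ∘ suc))

module _ {A : Set} where

  -- r ─ w₀ ─ ⋯ ─ w_{k-1} ─ m is properly colored.  For an arm, r is the root's color and m the
  -- color missing from the leaf's list, which the leaf must avoid as if it were a further neighbor.
  data Path : A → ∀ {k} → Vec A k → A → Set where
    end : ∀ {r m} → r ≢ m → Path r [] m
    _∷_ : ∀ {r c k m} {w : Vec A k} → r ≢ c → Path c w m → Path r (c ∷ w) m

  path-first : ∀ {r m k} {w : Vec A k} → Path r w m → (j : Fin k) → toℕ j ≡ 0 → r ≢ lookup w j
  path-first (r≢c ∷ _) zero _ = r≢c

  path-step : ∀ {r m k} {w : Vec A k} → Path r w m →
              (j j′ : Fin k) → suc (toℕ j) ≡ toℕ j′ → lookup w j ≢ lookup w j′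
  path-step (_ ∷ p) zero    (suc j′) e = path-first p j′ (sym (suc-injective e))
  path-step (_ ∷ p) (suc j) (suc j′) e = path-step p j j′ (suc-injective e)

  path-last : ∀ {r m k} {w : Vec A k} → Path r w m → (j : Fin k) → suc (toℕ j) ≡ k → lookup w j ≢ m
  path-last (_ ∷ end c≢m) zero    _ = c≢m
  path-last (_ ∷ (_ ∷ _)) zero    ()
  path-last (_ ∷ p)       (suc j) e = path-last p j (suc-injective e)

paths : (r : Color) (k : ℕ) (m : Color) → List (Σ (Vec Color k) λ w → Path r w m)
paths r zero m with r ≟ m
... | yes _   = []
... | no r≢m = [ [] , end r≢m ]
paths r (suc k) m = concatMap extend (List.allFin 3)
  where
  extend : Color → List (Σ (Vec Color (suc k)) λ w → Path r w m)
  extend c with r ≟ c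
  ... | yes _   = []
  ... | no r≢c = map (λ (w , p) → c ∷ w , r≢c ∷ p) (paths c k m)

-- Arm gadgets

ArmType : Set
ArmType = ℕ × Color

ArmLength : ℕ → Set
ArmLength k = k ≡ 1 ⊎ k ≡ 2 ⊎ k ≡ 4

record Gadget : Set where
  field
    base : Counts
    pairs singles : ℕ
open Gadget

gadget : Color → ArmType → Gadget
gadget r (1 , m) with r ≟ m
... | yes _ = record { base = replicate 3 0                         ; pairs = 0 ; singles = 1 }
... | no _  = record { base = zipWith _*_ (omitting r) (omitting m) ; pairs = 0 ; singles = 0 }
gadget r (2 , m) with r ≟ m
... | yes _ = record { base = omitting r                            ; pairs = 0 ; singles = 0 }
... | no _  = record { base = replicate 3 0                         ; pairs = 1 ; singles = 0 }
gadget r (4 , m) with r ≟ m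
... | yes _ = record { base = omitting r                            ; pairs = 1 ; singles = 0 }
... | no _  = record { base = replicate 3 0                         ; pairs = 2 ; singles = 0 }
gadget r _  = record { base = replicate 3 0                         ; pairs = 0 ; singles = 0 }

fill : Color → (g : Gadget) → Vec Color (pairs g) → Vec (Fin 2) (singles g) → Counts
fill r g os qs = base g ⊕ tally omitting os ⊕ tally (unit ∘ punchIn r) qs

all-vec? : ∀ {a n k} {P : Vec (Fin k) n → Set a} → (∀ v → Dec (P v)) → Dec (∀ v → P v)
all-vec? {n = zero}  P? = map′ (λ { p [] → p }) (λ f → f []) (P? [])
all-vec? {n = suc n} P? = map′ (λ f → λ { (x ∷ v) → f x v }) (λ f x v → f (x ∷ v))
                                (all? λ x → all-vec? λ v → P? (x ∷ v))

Realizable : Color → ArmType → Set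
Realizable r (k , m) =
  ∀ os qs → Any (λ (w , _) → tally unit w ≡ fill r (gadget r (k , m)) os qs) (paths r k m)

realizable? : ∀ r t → Dec (Realizable r t)
realizable? r (k , m) =
  all-vec? λ os → all-vec? λ qs → any? (λ (w , _) → Vecₚ.≡-dec ℕ._≟_ _ _) (paths r k m)

-- Facts found by evaluation are proved as b ≡ true by refl rather than as T b: an argument
-- of type T b is eta-expanded at each use, which evaluates b all over again.
decided : ∀ {a} {A : Set a} (a? : Dec A) → does a? ≡ true → A
decided (yes a) _ = a
decided (no _)  ()

realizationTable : ∀ r m → All (λ k → Realizable r (k , m)) (1 ∷ 2 ∷ 4 ∷ [])
realizationTable = decided (all? λ r → all? λ m → All.all? (λ k → realizable? r (k , m)) (1 ∷ 2 ∷ 4 ∷ [])) refl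

realizable : ∀ r m {k} → ArmLength k → Realizable r (k , m)
realizable r m len = pick len (realizationTable r m)
  where
  pick : ∀ {k} → ArmLength k → All (λ k → Realizable r (k , m)) (1 ∷ 2 ∷ 4 ∷ []) → Realizable r (k , m)
  pick (inj₁ refl)        (h₁ ∷ _)         = h₁
  pick (inj₂ (inj₁ refl)) (_ ∷ h₂ ∷ _)     = h₂
  pick (inj₂ (inj₂ refl)) (_ ∷ _ ∷ h₄ ∷ _) = h₄

armColoring : ∀ r m {k} → ArmLength k → (os : Vec Color (pairs (gadget r (k , m))))
               (qs : Vec (Fin 2) (singles (gadget r (k , m)))) →
               Σ (Vec Color k) λ w → Path r w m × tally unit w ≡ fill r (gadget r (k , m)) os qs
armColoring r m len os qs = proj₁ (proj₁ found) , proj₂ (proj₁ found) , proj₂ found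
  where found = satisfied (realizable r m len os qs)

excluded : Subset 3 → Color
excluded (outside ∷ _)          = zero
excluded (inside ∷ outside ∷ _) = suc zero
excluded (inside ∷ inside ∷ _)  = suc (suc zero)

∈-unless-excluded : ∀ L → ∣ L ∣ ≡ 2 → ∀ c → c ≢ excluded L → c ∈ L
∈-unless-excluded (outside ∷ inside ∷ inside ∷ [])   _ zero             c≢ = ⊥-elim (c≢ refl)
∈-unless-excluded (outside ∷ inside ∷ inside ∷ [])   _ (suc zero)       _  = there here
∈-unless-excluded (outside ∷ inside ∷ inside ∷ [])   _ (suc (suc zero)) _  = there (there here)
∈-unless-excluded (inside ∷ outside ∷ inside ∷ [])   _ zero             _  = here
∈-unless-excluded (inside ∷ outside ∷ inside ∷ [])   _ (suc zero)       c≢ = ⊥-elim (c≢ refl)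
∈-unless-excluded (inside ∷ outside ∷ inside ∷ [])   _ (suc (suc zero)) _  = there (there here)
∈-unless-excluded (inside ∷ inside ∷ outside ∷ [])   _ zero             _  = here
∈-unless-excluded (inside ∷ inside ∷ outside ∷ [])   _ (suc zero)       _  = there here
∈-unless-excluded (inside ∷ inside ∷ outside ∷ [])   _ (suc (suc zero)) c≢ = ⊥-elim (c≢ refl)
∈-unless-excluded (outside ∷ outside ∷ outside ∷ []) ()
∈-unless-excluded (outside ∷ outside ∷ inside ∷ [])  ()
∈-unless-excluded (outside ∷ inside ∷ outside ∷ [])  ()
∈-unless-excluded (inside ∷ outside ∷ outside ∷ [])  ()
∈-unless-excluded (inside ∷ inside ∷ inside ∷ [])    ()

lastOr : ∀ {A : Set} n → A → (Fin n → A) → A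
lastOr zero    a f = a
lastOr (suc n) a f = f (fromℕ n)

lastOr-last : ∀ {A : Set} n a (f : Fin n → A) j → suc (toℕ j) ≡ n → lastOr n a f ≡ f j
lastOr-last (suc n) a f j e = cong f (toℕ-injective (trans (toℕ-fromℕ n) (sym (suc-injective e))))

Word : (arms : List ℕ) → Fin (length arms) → Set
Word arms i = Vec Color (List.lookup arms i)

module _ {arms : List ℕ} where

  starColoring : Color → ((i : Fin (length arms)) → Word arms i) → Vtx arms → Color
  starColoring r W root       = r
  starColoring r W (node i j) = lookup (W i) j

  leafList : (Vtx arms → Subset 3) → Fin (length arms) → Subset 3
  leafList ℓ i = lastOr (List.lookup arms i) ⊤ (ℓ ∘ node i)

  armType : (Vtx arms → Subset 3) → Fin (length arms) → ArmType
  armType ℓ i = List.lookup arms i , excluded (leafList ℓ i)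

  starColoring-proper : ∀ ℓ r (W : (i : Fin (length arms)) → Word arms i) →
    r ∈ ℓ root → (∀ v → IsInner arms v → ℓ v ≡ ⊤) → (∀ v → IsLeaf arms v → ∣ ℓ v ∣ ≡ 2) →
    (∀ i → Path r (W i) (excluded (leafList ℓ i))) →
    IsProperLColoring arms ℓ (starColoring r W)
  starColoring-proper ℓ r W r∈ inner⊤ leaf₂ path = inList , proper
    where
    inList : ∀ v → starColoring r W v ∈ ℓ v
    inList root = r∈
    inList (node i j) with m≤n⇒m<n∨m≡n (toℕ<n j)
    ... | inj₁ j<last = subst (lookup (W i) j ∈_) (sym (inner⊤ _ (inner i j j<last))) ∈⊤
    ... | inj₂ j≡last = ∈-unless-excluded (ℓ (node i j)) (leaf₂ _ (leaf i j j≡last)) (lookup (W i) j)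
          (subst (λ L → lookup (W i) j ≢ excluded L) (lastOr-last _ ⊤ (ℓ ∘ node i) j j≡last)
                 (path-last (path i) j j≡last))
    proper : ∀ u v → Edge arms u v → starColoring r W u ≢ starColoring r W v
    proper _ _ (rootE i j j≡0)  = path-first (path i) j j≡0
    proper _ _ (armE i j k j→k) = path-step (path i) j k j→k

  classSize-starColoring : ∀ r (W : (i : Fin (length arms)) → Word arms i) c →
    classSize arms (starColoring r W) c ≡ lookup (unit r) c + ∑ (λ i → lookup (tally unit (W i)) c)
  classSize-starColoring r W c = begin
    length (filter (λ v → col v ≟ c) (allVtx arms))
      ≡⟨ length-filter≡sum (λ v → col v ≟ c) (allVtx arms) ⟩
    is r + sum (map (is ∘ col) (concatMap nodes (List.allFin (length arms))))
      ≡⟨ cong₂ _+_ (sym (lookup-unit r c)) (sum-map-concatMap (is ∘ col) nodes (List.allFin (length arms))) ⟩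
    lookup (unit r) c + sum (map (sum ∘ map (is ∘ col) ∘ nodes) (List.allFin (length arms)))
      ≡⟨ cong (lookup (unit r) c +_) (trans (sum-map-tabulate (sum ∘ map (is ∘ col) ∘ nodes) id) (sum-cong-≗ arm)) ⟩
    lookup (unit r) c + ∑ (λ i → lookup (tally unit (W i)) c) ∎
    where
    open ≡-Reasoning
    col = starColoring r W
    is : Color → ℕ
    is x = indicator (does (x ≟ c))
    nodes : (i : Fin (length arms)) → List (Vtx arms)
    nodes i = map (node i) (List.allFin (List.lookup arms i))
    arm : ∀ i → sum (map (is ∘ col) (nodes i)) ≡ lookup (tally unit (W i)) c
    arm i = begin
      sum (map (is ∘ col) (map (node i) (List.allFin k))) ≡⟨ cong sum (sym (Listₚ.map-∘ (List.allFin k))) ⟩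
      sum (map (is ∘ lookup (W i)) (List.allFin k))        ≡⟨ sum-map-tabulate (is ∘ lookup (W i)) id ⟩
      ∑ (is ∘ lookup (W i))                                 ≡⟨ sym (lookup-tally-unit (W i) c) ⟩
      lookup (tally unit (W i)) c                           ∎
      where k = List.lookup arms i

module _ {arms : List ℕ} (ℓ : Vtx arms → Subset 3) (lengths : ∀ i → ArmLength (List.lookup arms i))
         (r : Color) (os : Vec Color (∑ (pairs ∘ gadget r ∘ armType ℓ)))
         (qs : Vec (Fin 2) (∑ (singles ∘ gadget r ∘ armType ℓ))) where

  slotWord : ∀ i → Σ (Word arms i) λ w →
             Path r w (excluded (leafList ℓ i)) ×
             tally unit w ≡ fill r (gadget r (armType ℓ i)) (split _ os i) (split _ qs i)
  slotWord i = armColoring r (excluded (leafList ℓ i)) (lengths i) (split _ os i) (split _ qs i)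

  slotColoring : Vtx arms → Color
  slotColoring = starColoring r (proj₁ ∘ slotWord)

  classSize-slotColoring : ∀ c → classSize arms slotColoring c ≡
    lookup (unit r) c + ∑ (λ i → lookup (base (gadget r (armType ℓ i))) c)
      + lookup (tally omitting os) c + lookup (tally (unit ∘ punchIn r) qs) c
  classSize-slotColoring c = begin
    classSize arms slotColoring c
      ≡⟨ classSize-starColoring r (proj₁ ∘ slotWord) c ⟩
    u + ∑ (λ i → lookup (tally unit (proj₁ (slotWord i))) c)
      ≡⟨ cong (u +_) (sum-cong-≗ arm) ⟩
    u + ∑ (λ i → B i + O i + Q i)
      ≡⟨ cong (u +_) (trans (∑-distrib-+ (λ i → B i + O i) Q) (cong (_+ ∑ Q) (∑-distrib-+ B O))) ⟩
    u + (∑ B + ∑ O + ∑ Q)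
      ≡⟨ cong₂ (λ x y → u + (∑ B + x + y)) (tally-split omitting (pairs ∘ gadget r ∘ armType ℓ) os c)
                                            (tally-split (unit ∘ punchIn r) (singles ∘ gadget r ∘ armType ℓ) qs c) ⟩
    u + (∑ B + lookup (tally omitting os) c + lookup (tally (unit ∘ punchIn r) qs) c)
      ≡⟨ sym (+-assoc u _ _) ⟩
    u + (∑ B + lookup (tally omitting os) c) + lookup (tally (unit ∘ punchIn r) qs) c
      ≡⟨ cong (_+ lookup (tally (unit ∘ punchIn r) qs) c) (sym (+-assoc u (∑ B) _)) ⟩
    u + ∑ B + lookup (tally omitting os) c + lookup (tally (unit ∘ punchIn r) qs) c ∎
    where
    open ≡-Reasoning
    u = lookup (unit r) c
    B O Q : Fin (length arms) → ℕ
    B i = lookup (base (gadget r (armType ℓ i))) c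
    O i = lookup (tally omitting (split _ os i)) c
    Q i = lookup (tally (unit ∘ punchIn r) (split _ qs i)) c
    arm : ∀ i → lookup (tally unit (proj₁ (slotWord i))) c ≡ B i + O i + Q i
    arm i = begin
      lookup (tally unit (proj₁ (slotWord i))) c
        ≡⟨ cong (λ x → lookup x c) (proj₂ (proj₂ (slotWord i))) ⟩
      lookup (fill r (gadget r (armType ℓ i)) (split _ os i) (split _ qs i)) c
        ≡⟨ lookup-⊕ (base (gadget r (armType ℓ i)) ⊕ tally omitting (split _ os i)) _ c ⟩
      lookup (base (gadget r (armType ℓ i)) ⊕ tally omitting (split _ os i)) c + Q i
        ≡⟨ cong (_+ Q i) (lookup-⊕ (base (gadget r (armType ℓ i))) _ c) ⟩
      B i + O i + Q i ∎

weighted : ∀ {A : Set} {n} → Vec ℕ n → Vec A n → (A → ℕ) → ℕ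
weighted []      []       f = 0
weighted (k ∷ v) (u ∷ us) f = k * f u + weighted v us f

histogram : ∀ {N n} → (Fin N → Fin n) → Vec ℕ n
histogram ι = Vec.tabulate λ j → ∑ λ i → indicator (does (ι i ≟ j))

module _ {A : Set} where

  weighted-zero : ∀ {n} (us : Vec A n) f → weighted (Vec.tabulate λ _ → 0) us f ≡ 0
  weighted-zero []       f = refl
  weighted-zero (u ∷ us) f = weighted-zero us f

  weighted-+ : ∀ {n} (a b : Fin n → ℕ) (us : Vec A n) f →
    weighted (Vec.tabulate λ j → a j + b j) us f ≡ weighted (Vec.tabulate a) us f + weighted (Vec.tabulate b) us f
  weighted-+ a b []       f = refl
  weighted-+ a b (u ∷ us) f = begin
    (a zero + b zero) * f u + weighted (Vec.tabulate λ j → a (suc j) + b (suc j)) us f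
      ≡⟨ cong₂ _+_ (*-distribʳ-+ (f u) (a zero) (b zero)) (weighted-+ (a ∘ suc) (b ∘ suc) us f) ⟩
    a zero * f u + b zero * f u + (weighted-a + weighted-b)
      ≡⟨ interchange (a zero * f u) _ _ _ ⟩
    a zero * f u + weighted-a + (b zero * f u + weighted-b) ∎
    where
    open ≡-Reasoning
    weighted-a = weighted (Vec.tabulate (a ∘ suc)) us f
    weighted-b = weighted (Vec.tabulate (b ∘ suc)) us f

  weighted-point : ∀ {n} (j : Fin n) (us : Vec A n) f →
    weighted (Vec.tabulate λ j′ → indicator (does (j ≟ j′))) us f ≡ f (lookup us j)
  weighted-point zero    (u ∷ us) f = begin
    f u + 0 + weighted (Vec.tabulate λ _ → 0) us f ≡⟨ cong₂ _+_ (+-identityʳ (f u)) (weighted-zero us f) ⟩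
    f u + 0                                       ≡⟨ +-identityʳ (f u) ⟩
    f u                                           ∎
    where open ≡-Reasoning
  weighted-point (suc j) (u ∷ us) f = weighted-point j us f

  weighted-histogram : ∀ {N n} (ι : Fin N → Fin n) (us : Vec A n) f →
    weighted (histogram ι) us f ≡ ∑ (f ∘ lookup us ∘ ι)
  weighted-histogram {zero}  ι us f = weighted-zero us f
  weighted-histogram {suc N} ι us f = begin
    weighted (histogram ι) us f
      ≡⟨ weighted-+ (λ j → indicator (does (ι zero ≟ j))) _ us f ⟩
    weighted (Vec.tabulate λ j → indicator (does (ι zero ≟ j))) us f + weighted (histogram (ι ∘ suc)) us f
      ≡⟨ cong₂ _+_ (weighted-point (ι zero) us f) (weighted-histogram (ι ∘ suc) us f) ⟩
    f (lookup us (ι zero)) + ∑ (f ∘ lookup us ∘ ι ∘ suc) ∎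
    where open ≡-Reasoning

  weighted-one : ∀ {n} (v : Vec ℕ n) (us : Vec A n) → weighted v us (λ _ → 1) ≡ Vec.sum v
  weighted-one []      []       = refl
  weighted-one (k ∷ v) (u ∷ us) = cong₂ _+_ (*-identityʳ k) (weighted-one v us)

armTypes : Vec ArmType 9
armTypes = (1 , c1) ∷ (1 , c2) ∷ (1 , c3) ∷ (2 , c1) ∷ (2 , c2) ∷ (2 , c3) ∷ (4 , c1) ∷ (4 , c2) ∷ (4 , c3) ∷ []

typeIndex : ArmType → Fin 9
typeIndex (1 , m) = m ↑ˡ 6
typeIndex (2 , m) = 3 ↑ʳ (m ↑ˡ 3)
typeIndex (4 , m) = 6 ↑ʳ m
typeIndex _       = zero

lookup-typeIndex : ∀ {k} → ArmLength k → ∀ m → lookup armTypes (typeIndex (k , m)) ≡ (k , m)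
lookup-typeIndex (inj₁ refl)        zero             = refl
lookup-typeIndex (inj₁ refl)        (suc zero)       = refl
lookup-typeIndex (inj₁ refl)        (suc (suc zero)) = refl
lookup-typeIndex (inj₂ (inj₁ refl)) zero             = refl
lookup-typeIndex (inj₂ (inj₁ refl)) (suc zero)       = refl
lookup-typeIndex (inj₂ (inj₁ refl)) (suc (suc zero)) = refl
lookup-typeIndex (inj₂ (inj₂ refl)) zero             = refl
lookup-typeIndex (inj₂ (inj₂ refl)) (suc zero)       = refl
lookup-typeIndex (inj₂ (inj₂ refl)) (suc (suc zero)) = refl

record Profile : Set where
  field
    fixed : Counts
    pairSlots singleSlots : ℕ
open Profile

addGadget : ℕ → Gadget → Profile → Profile
addGadget k g p = record
  { fixed       = zipWith (λ a b → k * a + b) (base g) (fixed p)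
  ; pairSlots   = k * pairs g + pairSlots p
  ; singleSlots = k * singles g + singleSlots p
  }

profile : Color → ∀ {n} → Vec ℕ n → Vec ArmType n → Profile
profile r []              []       = record { fixed = unit r ; pairSlots = 0 ; singleSlots = 0 }
profile r (zero ∷ v)      (_ ∷ us) = profile r v us
profile r (k@(suc _) ∷ v) (u ∷ us) = addGadget k (gadget r u) (profile r v us)

fixed-profile : ∀ r {n} (v : Vec ℕ n) us c →
  lookup (fixed (profile r v us)) c ≡ lookup (unit r) c + weighted v us (λ u → lookup (base (gadget r u)) c)
fixed-profile r []              []       c = sym (+-identityʳ _)
fixed-profile r (zero ∷ v)      (u ∷ us) c = fixed-profile r v us c
fixed-profile r (k@(suc _) ∷ v) (u ∷ us) c = begin
  lookup (zipWith (λ a b → k * a + b) (base (gadget r u)) (fixed (profile r v us))) c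
    ≡⟨ Vecₚ.lookup-zipWith (λ a b → k * a + b) c (base (gadget r u)) _ ⟩
  k * B u + lookup (fixed (profile r v us)) c
    ≡⟨ cong (k * B u +_) (fixed-profile r v us c) ⟩
  k * B u + (lookup (unit r) c + weighted v us B)
    ≡⟨ x∙yz≈y∙xz (k * B u) (lookup (unit r) c) _ ⟩
  lookup (unit r) c + (k * B u + weighted v us B) ∎
  where
  open ≡-Reasoning
  B : ArmType → ℕ
  B u = lookup (base (gadget r u)) c

pairSlots-profile : ∀ r {n} (v : Vec ℕ n) us → pairSlots (profile r v us) ≡ weighted v us (pairs ∘ gadget r)
pairSlots-profile r []              []       = refl
pairSlots-profile r (zero ∷ v)      (_ ∷ us) = pairSlots-profile r v us
pairSlots-profile r (k@(suc _) ∷ v) (u ∷ us) = cong (k * pairs (gadget r u) +_) (pairSlots-profile r v us)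

singleSlots-profile : ∀ r {n} (v : Vec ℕ n) us →
                      singleSlots (profile r v us) ≡ weighted v us (singles ∘ gadget r)
singleSlots-profile r []              []       = refl
singleSlots-profile r (zero ∷ v)      (_ ∷ us) = singleSlots-profile r v us
singleSlots-profile r (k@(suc _) ∷ v) (u ∷ us) =
  cong (k * singles (gadget r u) +_) (singleSlots-profile r v us)

record SlotChoice (r : Color) (p : Profile) (t : Counts) : Set where
  field
    omissions : Vec Color (pairSlots p)
    choices   : Vec (Fin 2) (singleSlots p)
    achieves  : t ≡ fixed p ⊕ tally omitting omissions ⊕ tally (unit ∘ punchIn r) choices

spread : ∀ {n} (y : Vec ℕ n) → Vec (Fin n) (Vec.sum y)
spread []       = []
spread (y ∷ ys) = replicate y zero ++ Vec.map suc (spread ys)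

Fits : Color → Profile → Counts → Vec ℕ 3 → Vec ℕ 2 → Set
Fits r p t y w = Vec.sum y ≡ pairSlots p × Vec.sum w ≡ singleSlots p ×
                 t ≡ fixed p ⊕ tally omitting (spread y) ⊕ tally (unit ∘ punchIn r) (spread w)

fits? : ∀ r p t y w → Dec (Fits r p t y w)
fits? r p t y w = (Vec.sum y ℕ.≟ pairSlots p) ×-dec (Vec.sum w ℕ.≟ singleSlots p) ×-dec Vecₚ.≡-dec ℕ._≟_ t _

Fits⇒SlotChoice : ∀ {r p t y w} → Fits r p t y w → SlotChoice r p t
Fits⇒SlotChoice {r} {p} {y = y} {w} (y-size , w-size , achieves) = record
  { omissions = cast y-size (spread y)
  ; choices   = cast w-size (spread w)
  ; achieves  = trans achieves
      (cong₂ _⊕_ (cong (fixed p ⊕_) (sym (tally-cast omitting y-size (spread y))))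
                 (sym (tally-cast (unit ∘ punchIn r) w-size (spread w))))
  }

-- The first color other than r takes as few single slots as the pair slots allow;
-- the numbers of omitted colors are then forced by the target counts t.
singlesFor : Color → Profile → Counts → Vec ℕ 2
singlesFor r p t = n ∷ singleSlots p ∸ n ∷ []
  where n = lookup t (punchIn r zero) ∸ lookup (fixed p) (punchIn r zero) ∸ pairSlots p

omissionsFor : Color → Profile → Counts → Vec ℕ 2 → Counts
omissionsFor r p t w = zipWith _∸_ (Vec.map (pairSlots p +_) (fixed p) ⊕ tally (unit ∘ punchIn r) (spread w)) t

fitsTarget? : ∀ r p t → Dec (Fits r p t (omissionsFor r p t (singlesFor r p t)) (singlesFor r p t))
fitsTarget? r p t = fits? r p t (omissionsFor r p t (singlesFor r p t)) (singlesFor r p t)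

-- The exhaustive check

target : ℕ → Counts
target s = (s + 2) / 3 ∷ (s + 1) / 3 ∷ s / 3 ∷ []

armsOfLength : ℕ → Vec ℕ 9 → ℕ
armsOfLength k v = weighted v armTypes (indicator ∘ does ∘ (ℕ._≟ k) ∘ proj₁)

vertices : Vec ℕ 9 → ℕ
vertices v = suc (weighted v armTypes proj₁)

Admissible : ℕ → ℕ → ℕ → ℕ → Set
Admissible a₁ a₂ a₄ s = a₁ + a₂ ≤ 4 × a₁ + 1 + epsilon s ≤ 2 * a₄ + a₂

admissible? : ∀ v → Dec (Admissible (armsOfLength 1 v) (armsOfLength 2 v) (armsOfLength 4 v) (vertices v))
admissible? v = (_ ℕ.≤? 4) ×-dec (_ ℕ.≤? _)

goodRoots : Vec ℕ 9 → Subset 3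
goodRoots v = Vec.tabulate (λ r → does (fitsTarget? r (profile r v armTypes) (target (vertices v))))

claim : Vec ℕ 9 → Bool
claim v = not (does (admissible? v)) ∨ does (2 ℕ.≤? ∣ goodRoots v ∣)

allUpTo : ℕ → (ℕ → Bool) → Bool
allUpTo zero    p = p 0
allUpTo (suc k) p = p (suc k) ∧ allUpTo k p

allBounded : ∀ n → ℕ → (Vec ℕ n → Bool) → Bool
allBounded zero    k P = P []
allBounded (suc n) k P = allUpTo k λ x → allBounded n (k ∸ x) (P ∘ (x ∷_))

checked : allBounded 9 6 claim ≡ true
checked = refl

∧-true : ∀ a b → a ∧ b ≡ true → a ≡ true × b ≡ true
∧-true true true _ = refl , refl

allUpTo-sound : ∀ k p {x} → x ≤ k → allUpTo k p ≡ true → p x ≡ true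
allUpTo-sound zero    p z≤n h = h
allUpTo-sound (suc k) p x≤k h with m≤n⇒m<n∨m≡n x≤k | ∧-true (p (suc k)) (allUpTo k p) h
... | inj₂ refl | now , _     = now
... | inj₁ x<k  | _   , later = allUpTo-sound k p (≤-pred x<k) later

allBounded-sound : ∀ n k P → allBounded n k P ≡ true → ∀ v → Vec.sum v ≤ k → P v ≡ true
allBounded-sound zero    k P h []      _ = h
allBounded-sound (suc n) k P h (x ∷ v) x+v≤k =
  allBounded-sound n (k ∸ x) (P ∘ (x ∷_))
    (allUpTo-sound k (λ x → allBounded n (k ∸ x) (P ∘ (x ∷_))) (m+n≤o⇒m≤o x x+v≤k) h)
    v (m+n≤o⇒m≤o∸n (Vec.sum v) (subst (_≤ k) (+-comm x (Vec.sum v)) x+v≤k))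

twoGoodRoots : ∀ v → Vec.sum v ≤ 6 →
  Admissible (armsOfLength 1 v) (armsOfLength 2 v) (armsOfLength 4 v) (vertices v) → 2 ≤ ∣ goodRoots v ∣
twoGoodRoots v v≤6 adm = decided (2 ℕ.≤? ∣ goodRoots v ∣)
  (implied (does (admissible? v)) _ (allBounded-sound 9 6 claim checked v v≤6) (dec-true (admissible? v) adm))
  where
  implied : ∀ a b → not a ∨ b ≡ true → a ≡ true → b ≡ true
  implied true b h _ = h

goodRoot⇒SlotChoice : ∀ v r → r ∈ goodRoots v → SlotChoice r (profile r v armTypes) (target (vertices v))
goodRoot⇒SlotChoice v r r∈ =
  Fits⇒SlotChoice {y = omissionsFor r p t (singlesFor r p t)} {w = singlesFor r p t}
                  (decided (fitsTarget? r p t) good)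
  where
  p = profile r v armTypes
  t = target (vertices v)
  good : does (fitsTarget? r p t) ≡ true
  good = trans (sym (Vecₚ.lookup∘tabulate (λ r → does (fitsTarget? r (profile r v armTypes) t)) r))
               (Vecₚ.[]=⇒lookup r∈)

target-balanced : ∀ s → lookup (target s) c2 ≤ lookup (target s) c1 ×
                        lookup (target s) c3 ≤ lookup (target s) c2 ×
                        lookup (target s) c1 ≤ suc (lookup (target s) c3)
target-balanced s =
    /-monoˡ-≤ 3 (+-monoʳ-≤ s (n≤1+n 1))
  , /-monoˡ-≤ 3 (m≤m+n s 1)
  , ≤-trans (/-monoˡ-≤ 3 (+-monoʳ-≤ s (n≤1+n 2)))
            (≤-reflexive (trans (m/n≡1+[m∸n]/n (m≤n+m 3 s)) (cong (λ x → suc (x / 3)) (m+n∸n≡m s 3))))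

target⇒descEquitable : ∀ {arms} (col : Vtx arms → Color) s →
  (∀ c → classSize arms col c ≡ lookup (target s) c) → DescEquitable arms col
target⇒descEquitable col s sizes with target-balanced s
... | b₂₁ , b₃₂ , b₁₃ = subst₂ _≤_ (sym (sizes c2)) (sym (sizes c1)) b₂₁
                      , subst₂ _≤_ (sym (sizes c3)) (sym (sizes c2)) b₃₂
                      , subst₂ _≤_ (sym (sizes c1)) (cong suc (sym (sizes c3))) b₁₃

numArms-∑ : ∀ arms k → numArms arms k ≡ ∑ (λ i → indicator (does (List.lookup arms i ℕ.≟ k)))
numArms-∑ arms k = begin
  length (filter (ℕ._≟ k) arms)                     ≡⟨ length-filter≡sum (ℕ._≟ k) arms ⟩
  sum (map is-k arms)                               ≡⟨ cong (sum ∘ map is-k) (sym (Listₚ.tabulate-lookup arms)) ⟩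
  sum (map is-k (List.tabulate (List.lookup arms))) ≡⟨ sum-map-tabulate is-k (List.lookup arms) ⟩
  ∑ (is-k ∘ List.lookup arms)                       ∎
  where
  open ≡-Reasoning
  is-k : ℕ → ℕ
  is-k = indicator ∘ does ∘ (ℕ._≟ k)

order-∑ : ∀ arms → order arms ≡ suc (∑ (List.lookup arms))
order-∑ arms = cong suc (begin
  length (concatMap nodes (List.allFin (length arms)))   ≡⟨ length-concatMap nodes (List.allFin (length arms)) ⟩
  sum (map (length ∘ nodes) (List.allFin (length arms))) ≡⟨ sum-map-tabulate (length ∘ nodes) id ⟩
  ∑ (length ∘ nodes)                                     ≡⟨ sum-cong-≗ armLength ⟩
  ∑ (List.lookup arms)                                   ∎)
  where
  open ≡-Reasoning
  nodes : (i : Fin (length arms)) → List (Vtx arms)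
  nodes i = map (node i) (List.allFin (List.lookup arms i))
  armLength : ∀ i → length (nodes i) ≡ List.lookup arms i
  armLength i = trans (Listₚ.length-map (node {arms} i) (List.allFin (List.lookup arms i)))
                      (Listₚ.length-tabulate {n = List.lookup arms i} id)

length-arms : ∀ {arms} → All ArmLength arms → length arms ≡ numArms arms 1 + numArms arms 2 + numArms arms 4
length-arms [] = refl
length-arms {_ ∷ xs} (inj₁ refl        ∷ ls) = cong suc (length-arms ls)
length-arms {_ ∷ xs} (inj₂ (inj₁ refl) ∷ ls) =
  trans (cong suc (length-arms ls)) (cong (_+ numArms xs 4) (sym (+-suc (numArms xs 1) (numArms xs 2))))
length-arms {_ ∷ xs} (inj₂ (inj₂ refl) ∷ ls) =
  trans (cong suc (length-arms ls)) (sym (+-suc (numArms xs 1 + numArms xs 2) (numArms xs 4)))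

there₂ : ∀ {n x y} {p q : Subset n} → (∃ λ z → z ∈ p × z ∈ q) → ∃ λ z → z ∈ x ∷ p × z ∈ y ∷ q
there₂ (z , z∈p , z∈q) = suc z , there z∈p , there z∈q

∩-nonempty : ∀ {n} (p q : Subset n) → n < ∣ p ∣ + ∣ q ∣ → ∃ λ x → x ∈ p × x ∈ q
∩-nonempty []            []            ()
∩-nonempty (inside ∷ p)  (inside ∷ q)  _ = zero , here , here
∩-nonempty (inside ∷ p)  (outside ∷ q) h = there₂ (∩-nonempty p q (s<s⁻¹ h))
∩-nonempty (outside ∷ p) (outside ∷ q) h = there₂ (∩-nonempty p q (<-trans (n<1+n _) h))
∩-nonempty {suc n} (outside ∷ p) (inside ∷ q) h =
  there₂ (∩-nonempty p q (s<s⁻¹ (subst (suc n <_) (+-suc ∣ p ∣ ∣ q ∣) h)))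

module _ {arms : List ℕ} (ℓ : Vtx arms → Subset 3) (lengths : All ArmLength arms) where

  lengthAt : ∀ i → ArmLength (List.lookup arms i)
  lengthAt i = All.lookup lengths (∈-lookup i)

  multiplicities : Vec ℕ 9
  multiplicities = histogram (typeIndex ∘ armType ℓ)

  weighted-multiplicities : ∀ f → weighted multiplicities armTypes f ≡ ∑ (f ∘ armType ℓ)
  weighted-multiplicities f = trans (weighted-histogram (typeIndex ∘ armType ℓ) armTypes f)
    (sum-cong-≗ λ i → cong f (lookup-typeIndex (lengthAt i) (excluded (leafList ℓ i))))

  sum-multiplicities : Vec.sum multiplicities ≡ length arms
  sum-multiplicities = trans (sym (weighted-one multiplicities armTypes))
                             (trans (weighted-multiplicities (λ _ → 1)) (∑-one (length arms)))

  armsOfLength-multiplicities : ∀ k → armsOfLength k multiplicities ≡ numArms arms k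
  armsOfLength-multiplicities k =
    trans (weighted-multiplicities (indicator ∘ does ∘ (ℕ._≟ k) ∘ proj₁)) (sym (numArms-∑ arms k))

  vertices-multiplicities : vertices multiplicities ≡ order arms
  vertices-multiplicities = trans (cong suc (weighted-multiplicities proj₁)) (sym (order-∑ arms))

  admissible-multiplicities :
    Admissible (numArms arms 1) (numArms arms 2) (numArms arms 4) (order arms) →
    Admissible (armsOfLength 1 multiplicities) (armsOfLength 2 multiplicities)
               (armsOfLength 4 multiplicities) (vertices multiplicities)
  admissible-multiplicities = subst (λ (a₁ , a₂ , a₄ , s) → Admissible a₁ a₂ a₄ s) (sym counts≡)
    where
    counts≡ = cong₂ _,_ (armsOfLength-multiplicities 1) (cong₂ _,_ (armsOfLength-multiplicities 2)
                (cong₂ _,_ (armsOfLength-multiplicities 4) vertices-multiplicities))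

  slotChoice⇒coloring : ∀ r t → r ∈ ℓ root →
    (∀ v → IsInner arms v → ℓ v ≡ ⊤) → (∀ v → IsLeaf arms v → ∣ ℓ v ∣ ≡ 2) →
    SlotChoice r (profile r multiplicities armTypes) t →
    Σ (Vtx arms → Color) λ col → IsProperLColoring arms ℓ col × (∀ c → classSize arms col c ≡ lookup t c)
  slotChoice⇒coloring r t r∈ inner⊤ leaf₂ choice = col , proper , sizes
    where
    open SlotChoice choice
    p = profile r multiplicities armTypes
    pairs≡ = trans (pairSlots-profile r multiplicities armTypes) (weighted-multiplicities (pairs ∘ gadget r))
    singles≡ = trans (singleSlots-profile r multiplicities armTypes) (weighted-multiplicities (singles ∘ gadget r))
    os = cast pairs≡ omissions
    qs = cast singles≡ choices
    col = slotColoring ℓ lengthAt r os qs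
    proper = starColoring-proper ℓ r _ r∈ inner⊤ leaf₂ (proj₁ ∘ proj₂ ∘ slotWord ℓ lengthAt r os qs)
    sizes : ∀ c → classSize arms col c ≡ lookup t c
    sizes c = begin
      classSize arms col c
        ≡⟨ classSize-slotColoring ℓ lengthAt r os qs c ⟩
      lookup (unit r) c + ∑ (B ∘ armType ℓ)
        + lookup (tally omitting os) c + lookup (tally (unit ∘ punchIn r) qs) c
        ≡⟨ cong₂ (λ x y → lookup (unit r) c + ∑ (B ∘ armType ℓ) + lookup x c + lookup y c)
                 (tally-cast omitting pairs≡ omissions) (tally-cast (unit ∘ punchIn r) singles≡ choices) ⟩
      lookup (unit r) c + ∑ (B ∘ armType ℓ) + O + Q
        ≡⟨ cong (λ x → lookup (unit r) c + x + O + Q) (sym (weighted-multiplicities B)) ⟩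
      lookup (unit r) c + weighted multiplicities armTypes B + O + Q
        ≡⟨ cong (λ x → x + O + Q) (sym (fixed-profile r multiplicities armTypes c)) ⟩
      lookup (fixed p) c + O + Q
        ≡⟨ cong (_+ Q) (sym (lookup-⊕ (fixed p) _ c)) ⟩
      lookup (fixed p ⊕ tally omitting omissions) c + Q
        ≡⟨ sym (lookup-⊕ (fixed p ⊕ tally omitting omissions) _ c) ⟩
      lookup (fixed p ⊕ tally omitting omissions ⊕ tally (unit ∘ punchIn r) choices) c
        ≡⟨ cong (λ x → lookup x c) (sym achieves) ⟩
      lookup t c ∎
      where
      open ≡-Reasoning
      B : ArmType → ℕ
      B u = lookup (base (gadget r u)) c
      O = lookup (tally omitting omissions) c
      Q = lookup (tally (unit ∘ punchIn r) choices) c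

lemma4p1 : (arms : List ℕ) → All (λ n → n ≡ 1 ⊎ n ≡ 2 ⊎ n ≡ 4) arms →
    (a0 : ℕ) →
    a0 + numArms arms 1 + numArms arms 2 + numArms arms 4 ≤ 6 →
    (ℓ : Vtx arms → Subset 3) →
    (∀ v → IsInner arms v → ℓ v ≡ ⊤) →
    (∀ v → IsLeaf arms v → ∣ ℓ v ∣ ≡ 2) →
    2 ≤ ∣ ℓ root ∣ →
    numArms arms 1 + 1 + epsilon (order arms) ≤ 2 * numArms arms 4 + numArms arms 2 →
    a0 + numArms arms 1 + numArms arms 2 + numArms arms 4 ≤ numArms arms 4 + 4 →
    DescEquitablyLColorable arms ℓ
lemma4p1 arms lengths a0 degree≤6 ℓ inner⊤ leaf₂ root₂ surplus degree≤a₄+4 =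
  let r , r∈ℓ , r-good = ∩-nonempty (ℓ root) (goodRoots v) (+-mono-≤ root₂ (twoGoodRoots v v≤6 admissible))
      col , proper , sizes = slotChoice⇒coloring ℓ lengths r (target (vertices v)) r∈ℓ inner⊤ leaf₂
                                                 (goodRoot⇒SlotChoice v r r-good)
  in col , proper , target⇒descEquitable col (vertices v) sizes
  where
  a₁ = numArms arms 1
  a₂ = numArms arms 2
  a₄ = numArms arms 4
  without-a0 : ∀ {n} → a0 + a₁ + a₂ + a₄ ≤ n → a₁ + a₂ + a₄ ≤ n
  without-a0 {n} h = ≤-trans (m≤n+m (a₁ + a₂ + a₄) a0)
    (subst (_≤ n) (trans (cong (_+ a₄) (+-assoc a0 a₁ a₂)) (+-assoc a0 (a₁ + a₂) a₄)) h)
  v = multiplicities ℓ lengths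
  v≤6 : Vec.sum v ≤ 6
  v≤6 = subst (_≤ 6) (sym (trans (sum-multiplicities ℓ lengths) (length-arms lengths))) (without-a0 degree≤6)
  a₁+a₂≤4 : a₁ + a₂ ≤ 4
  a₁+a₂≤4 = +-cancelʳ-≤ a₄ (a₁ + a₂) 4 (subst (a₁ + a₂ + a₄ ≤_) (+-comm a₄ 4) (without-a0 degree≤a₄+4))
  admissible = admissible-multiplicities ℓ lengths (a₁+a₂≤4 , surplus)
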